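{- Let $s\ge2$ and let $\mathcal{S}_m$ denote the star graph with one central vertex and $m$ leaves (equivalently $\mathcal{CT}(1,m)$). Then \[|\mathrm{Arith}(\mathcal{S}_s)|=1+\sum_{j=0}^{s-2}\binom{s}{j}\,\bigl|\mathrm{SArith}(\mathcal{S}_{s-j})\bigr|.\]
   Context: An arithmetical structure on a finite connected simple graph is a pair $(\mathbf{d},\mathbf{r})$ of vectors of positive integers indexed by the vertices such that for every vertex $v$, $d_vr_v$ equals the sum of $r_u$ over the neighbors $u$ of $v$, and the entries of $\mathbf{r}$ have gcd $1$; $\mathrm{Arith}(G)$ is the set of arithmetical structures on $G$. For the star $\mathcal{S}_m$ with central vertex $v_1$ and leaves $v_{\ell_1},\dots,v_{\ell_m}$, an arithmetical structure is smooth if $d_{\ell_1},\dots,d_{\ell_m}\ge2$ (no condition on the central vertex); $\mathrm{SArith}(\mathcal{S}_m)$ is the set of smooth arithmetical structures. -}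

module Defs where

open import Data.Nat using (ℕ; zero; suc; _+_; _*_; _≤_; _<_)
open import Data.Nat.GCD using (gcd)
open import Data.Bool using (Bool; true; false; if_then_else_)
open import Data.Fin using (Fin; zero; suc)
open import Data.Vec using (Vec; lookup; tabulate; foldr; sum)
open import Data.Vec.Relation.Unary.All using (All)
open import Data.List using (List; length)
open import Data.List.Membership.Propositional using (_∈_)
open import Data.List.Relation.Unary.Unique.Propositional using (Unique)
open import Data.Product using (Σ; _×_; _,_)
open import Function.Bundles using (_⇔_)
open import Relation.Binary.PropositionalEquality using (_≡_)

-- A finite simple graph on vertex set Fin n, given by a (symmetric, irreflexive)
-- Boolean adjacency relation.
Graph : ℕ → Set
Graph n = Fin n → Fin n → Bool

star : (m : ℕ) → Graph (suc m)
star m zero    zero    = false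
star m zero    (suc _) = true
star m (suc _) zero    = true
star m (suc _) (suc _) = false

neighbourSum : ∀ {n} → Graph n → Vec ℕ n → Fin n → ℕ
neighbourSum {n} G r v = sum (tabulate λ u → if G v u then lookup r u else 0)

gcdVec : ∀ {n} → Vec ℕ n → ℕ
gcdVec = foldr _ gcd 0

IsArith : ∀ {n} → Graph n → Vec ℕ n × Vec ℕ n → Set
IsArith {n} G (d , r) =
  All (0 <_) d × All (0 <_) r ×
  All (λ v → lookup d v * lookup r v ≡ neighbourSum G r v) (tabulate (λ v → v)) ×
  gcdVec r ≡ 1

IsSmoothArithStar : (m : ℕ) → Vec ℕ (suc m) × Vec ℕ (suc m) → Set
IsSmoothArithStar m (d , r) =
  IsArith (star m) (d , r) × All (λ i → 2 ≤ lookup d (suc i)) (tabulate (λ (i : Fin m) → i))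

HasCard : {A : Set} → (A → Set) → ℕ → Set
HasCard {A} P k = Σ (List A) λ L → length L ≡ k × Unique L × (∀ x → P x ⇔ x ∈ L)

module Submission where

-- Call a structure on the star prefix-smooth if its first q leaves have d ≥ 2, the other p
-- leaves being unconstrained, and look at its last leaf. If it has d = 1, its r equals the r of
-- the centre, and deleting it (lowering the d of the centre by one) leaves a prefix-smooth
-- structure with one leaf less; if it has d ≥ 2, moving it to the front makes it a constrained
-- leaf. So the counts obey Pascal's rule T(m+1, p+1) = T(m+1, p) + T(m, p), whence
-- T(m, p) = Σⱼ (p C j) |SArith(S_{m-j})|. For m = p = s the terms j = s - 1 and j = s are
-- |SArith(S₁)| = 0 and the one degenerate structure on the star without leaves.
-- SArith(Sₖ) is finite: the d's of the leaves satisfy Σᵢ 1/dᵢ = d₀, the d of the centre, so they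
-- obey the classical bound for Egyptian fractions; the r of the centre divides Πᵢ dᵢ; and d₀ ≤ k.

open import Defs
open import Data.Nat
  using (ℕ; zero; suc; _+_; _*_; _∸_; _^_; _≤_; _<_; _≤?_; _<?_; _≟_; z≤n; s≤s; z<s; >-nonZero)
open import Data.Nat.Properties
open import Data.Nat.GCD
  using (gcd; gcd-assoc; gcd-comm; gcd[m,n]∣m; gcd[m,n]∣n; gcd-greatest; gcd-identityʳ; c*gcd[m,n]≡gcd[cm,cn])
open import Data.Nat.Divisibility
  using (_∣_; _∣0; ∣-antisym; ∣-refl; ∣⇒≤; ∣m+n∣m⇒∣n; ∣n⇒∣m*n; n∣m*n; *-monoˡ-∣)
open import Data.Nat.Combinatorics using (_C_; nCn≡1; nCk+nC[k+1]≡[n+1]C[k+1])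
open import Data.Nat.ListAction using (sum; product)
open import Data.Nat.ListAction.Properties using (sum-++; sum-↭; ∈⇒∣product; product≢0)
open import Data.Nat.Tactic.RingSolver using (solve-∀)
open import Algebra.Properties.CommutativeSemigroup +-commutativeSemigroup using (x∙yz≈y∙xz; interchange)
open import Data.Fin using (zero; suc)
open import Data.List
  using (List; []; _∷_; _++_; map; length; take; filter; upTo; applyUpTo; cartesianProductWith; cartesianProduct)
open import Data.List.Properties using (length-++; length-map; take-all; applyUpTo-∷ʳ; map-upTo)
open import Data.List.Membership.Propositional using (_∈_)
open import Data.List.Membership.Propositional.Properties
  using ( ∈-map⁺; ∈-map⁻; ∈-++⁺ˡ; ∈-++⁺ʳ; ∈-++⁻; ∈-filter⁺; ∈-filter⁻; ∈-upTo⁺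
        ; ∈-cartesianProductWith⁺; ∈-cartesianProduct⁺; ∈-∃++)
open import Data.List.Relation.Unary.Any using (here; there)
open import Data.List.Relation.Unary.All as ListAll using ([]; _∷_)
open import Data.List.Relation.Unary.AllPairs using ([]; _∷_)
open import Data.List.Relation.Unary.Unique.Propositional using (Unique)
import Data.List.Relation.Unary.Unique.Propositional.Properties as Unique
open import Data.List.Relation.Binary.Permutation.Propositional using (_↭_; ↭-sym)
open import Data.List.Relation.Binary.Permutation.Propositional.Properties as ↭
  using (shift; All-resp-↭; ↭-length)
open import Data.Vec as Vec using (Vec; []; _∷_; _∷ʳ_; toList; lookup; tabulate; initLast)
open import Data.Vec.Properties
  using (∷-injective; ∷ʳ-injective; ∷ʳ-injectiveʳ; length-toList; tabulate∘lookup)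
open import Data.Vec.Relation.Unary.All as VecAll using ([]; _∷_)
import Data.Vec.Relation.Unary.All.Properties as VecAll
open import Data.Vec.Relation.Binary.Pointwise.Inductive as Pointwise using (Pointwise; []; _∷_)
import Data.Vec.Relation.Binary.Pointwise.Extensional as Extensional
open import Data.Product using (Σ; ∃; _×_; _,_; proj₁; proj₂; map₁)
open import Data.Product.Properties using (,-injectiveˡ; ,-injectiveʳ)
open import Data.Sum as Sum using (inj₁; inj₂)
open import Data.Empty using (⊥-elim)
open import Function using (_∘_)
open import Function.Bundles using (_⇔_; mk⇔; module Equivalence)
open Equivalence using (to; from)
open import Function.Definitions using (Injective)
open import Relation.Nullary using (Dec; yes; no; contradiction)
open import Relation.Nullary.Decidable using (_×-dec_; map′)
open import Relation.Unary using (_∪_; _≐_; _⊆_; _⊥_; Empty; Decidable; ｛_｝)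
open import Relation.Unary.Properties using (≐-sym)
open import Relation.Binary.PropositionalEquality
  using (_≡_; refl; sym; trans; cong; cong₂; subst; module ≡-Reasoning)

private variable
  A B : Set
  P Q : A → Set
  k m n q a b d₀ R : ℕ
  ds rs : Vec ℕ m

Image : (A → B) → (A → Set) → B → Set
Image f P y = ∃ λ x → P x × y ≡ f x

HasCard-resp-≐ : P ≐ Q → HasCard P n → HasCard Q n
HasCard-resp-≐ (P⊆Q , Q⊆P) (xs , len , unique , mem) =
  xs , len , unique , λ x → mk⇔ (to (mem x) ∘ Q⊆P) (P⊆Q ∘ from (mem x))

HasCard-∅ : Empty P → HasCard P 0
HasCard-∅ empty = [] , refl , [] , λ x → mk⇔ (⊥-elim ∘ empty x) λ ()

HasCard-｛｝ : (a : A) → HasCard ｛ a ｝ 1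
HasCard-｛｝ a =
  a ∷ [] , refl , [] ∷ [] , λ x → mk⇔ (λ { refl → here refl }) λ { (here refl) → refl }

HasCard-image : {f : A → B} → Injective _≡_ _≡_ f → HasCard P n → HasCard (Image f P) n
HasCard-image {f = f} f-injective (xs , len , unique , mem) =
  map f xs , trans (length-map f xs) len , Unique.map⁺ f-injective unique ,
  λ y → mk⇔ (λ { (x , px , refl) → ∈-map⁺ f (to (mem x) px) })
            (λ y∈ → let x , x∈ , y≡fx = ∈-map⁻ f y∈ in x , from (mem x) x∈ , y≡fx)

HasCard-∪ : P ⊥ Q → HasCard P m → HasCard Q n → HasCard (P ∪ Q) (m + n)
HasCard-∪ P⊥Q (xs , len₁ , unique₁ , mem₁) (ys , len₂ , unique₂ , mem₂) =
  xs ++ ys , trans (length-++ xs) (cong₂ _+_ len₁ len₂) ,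
  Unique.++⁺ unique₁ unique₂ (λ (∈xs , ∈ys) → P⊥Q (from (mem₁ _) ∈xs , from (mem₂ _) ∈ys)) ,
  λ x → mk⇔ (λ { (inj₁ px) → ∈-++⁺ˡ (to (mem₁ x) px)
                ; (inj₂ qx) → ∈-++⁺ʳ xs (to (mem₂ x) qx) })
            (Sum.map (from (mem₁ x)) (from (mem₂ x)) ∘ ∈-++⁻ xs)

HasCard-filter : (P? : Decidable P) (xs : List A) → Unique xs → (∀ x → P x → x ∈ xs) →
                 HasCard P (length (filter P? xs))
HasCard-filter P? xs unique complete =
  filter P? xs , refl , Unique.filter⁺ P? {xs = xs} unique ,
  λ x → mk⇔ (λ px → ∈-filter⁺ P? (complete x px) px) (proj₂ ∘ ∈-filter⁻ P? {xs = xs})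

boundedVecs : ℕ → (n : ℕ) → List (Vec ℕ n)
boundedVecs M zero    = [] ∷ []
boundedVecs M (suc n) = cartesianProductWith _∷_ (upTo (suc M)) (boundedVecs M n)

boundedVecs-unique : ∀ M n → Unique (boundedVecs M n)
boundedVecs-unique M zero    = [] ∷ []
boundedVecs-unique M (suc n) =
  Unique.cartesianProductWith⁺ _∷_ ∷-injective (Unique.upTo⁺ (suc M)) (boundedVecs-unique M n)

∈-boundedVecs : ∀ {M} {xs : Vec ℕ n} → VecAll.All (_≤ M) xs → xs ∈ boundedVecs M n
∈-boundedVecs []           = here refl
∈-boundedVecs (x≤M ∷ xs≤M) = ∈-cartesianProductWith⁺ _∷_ (∈-upTo⁺ (s≤s x≤M)) (∈-boundedVecs xs≤M)

finite-if-bounded : ∀ {P : Vec ℕ n × Vec ℕ n → Set} M → Decidable P →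
                    (∀ x → P x → VecAll.All (_≤ M) (proj₁ x) × VecAll.All (_≤ M) (proj₂ x)) →
                    Σ ℕ (HasCard P)
finite-if-bounded {n = n} M P? bounded =
  _ , HasCard-filter P? (cartesianProduct (boundedVecs M n) (boundedVecs M n))
        (Unique.cartesianProduct⁺ (boundedVecs-unique M n) (boundedVecs-unique M n))
        (λ x px → let ds≤M , rs≤M = bounded x px in
                  ∈-cartesianProduct⁺ (∈-boundedVecs ds≤M) (∈-boundedVecs rs≤M))

factors-positive : ∀ m n → m * n ≡ k → 0 < k → 0 < m × 0 < n
factors-positive zero    n       refl ()
factors-positive (suc m) (suc n) _    _   = z<s , z<s
factors-positive (suc m) zero    mn≡k 0<k =
  contradiction (subst (0 <_) (trans (sym mn≡k) (*-zeroʳ m)) 0<k) (<-irrefl refl)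

gcd-leftComm : ∀ a b c → gcd a (gcd b c) ≡ gcd b (gcd a c)
gcd-leftComm a b c = trans (sym (gcd-assoc a b c)) (trans (cong (λ g → gcd g c) (gcd-comm a b)) (gcd-assoc b a c))

gcd-absorbˡ : ∀ m n → gcd m (gcd m n) ≡ gcd m n
gcd-absorbˡ m n = ∣-antisym (gcd[m,n]∣n m _) (gcd-greatest (gcd[m,n]∣m m n) ∣-refl)

foldr-∷ʳ-comm : {f : A → A → A} → (∀ a b c → f a (f b c) ≡ f b (f a c)) →
                ∀ {e} x (xs : Vec A n) → Vec.foldr _ f e (xs ∷ʳ x) ≡ f x (Vec.foldr _ f e xs)
foldr-∷ʳ-comm         comm x []       = refl
foldr-∷ʳ-comm {f = f} comm x (y ∷ xs) = trans (cong (f y) (foldr-∷ʳ-comm comm x xs)) (comm y x _)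

sum-∷ʳ : ∀ x (xs : Vec ℕ n) → Vec.sum (xs ∷ʳ x) ≡ x + Vec.sum xs
sum-∷ʳ = foldr-∷ʳ-comm x∙yz≈y∙xz

gcdVec-∷ʳ : ∀ x (xs : Vec ℕ n) → gcdVec (xs ∷ʳ x) ≡ gcd x (gcdVec xs)
gcdVec-∷ʳ = foldr-∷ʳ-comm gcd-leftComm

∣-*-gcdVec : ∀ {c} {xs : Vec ℕ n} → VecAll.All (λ x → k ∣ c * x) xs → k ∣ c * gcdVec xs
∣-*-gcdVec {k = k} {c}                 []             = subst (k ∣_) (sym (*-zeroʳ c)) (k ∣0)
∣-*-gcdVec {k = k} {c} (_∷_ {x = x} k∣cx k∣c*xs) =
  subst (k ∣_) (sym (c*gcd[m,n]≡gcd[cm,cn] c x _)) (gcd-greatest k∣cx (∣-*-gcdVec {c = c} k∣c*xs))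

sum≤length*bound : ∀ {xs : Vec ℕ n} → VecAll.All (_≤ k) xs → Vec.sum xs ≤ n * k
sum≤length*bound []           = z≤n
sum≤length*bound (x≤k ∷ xs≤k) = +-mono-≤ x≤k (sum≤length*bound xs≤k)

product≤bound^length : ∀ {xs : Vec ℕ n} → VecAll.All (_≤ k) xs → product (toList xs) ≤ k ^ n
product≤bound^length []           = ≤-refl
product≤bound^length (x≤k ∷ xs≤k) = *-mono-≤ x≤k (product≤bound^length xs≤k)

Pointwise-∷ʳ⁺ : {_∼_ : A → B → Set} {xs : Vec A n} {ys : Vec B n} {x : A} {y : B} →
                Pointwise _∼_ xs ys → x ∼ y → Pointwise _∼_ (xs ∷ʳ x) (ys ∷ʳ y)
Pointwise-∷ʳ⁺ []            x∼y = x∼y ∷ []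
Pointwise-∷ʳ⁺ (x′∼y′ ∷ xs∼ys) x∼y = x′∼y′ ∷ Pointwise-∷ʳ⁺ xs∼ys x∼y

Pointwise-∷ʳ⁻ : {_∼_ : A → B → Set} (xs : Vec A n) (ys : Vec B n) {x : A} {y : B} →
                Pointwise _∼_ (xs ∷ʳ x) (ys ∷ʳ y) → Pointwise _∼_ xs ys × x ∼ y
Pointwise-∷ʳ⁻ []       []       (x∼y ∷ [])       = [] , x∼y
Pointwise-∷ʳ⁻ (_ ∷ xs) (_ ∷ ys) (x′∼y′ ∷ xs∼ys) = map₁ (x′∼y′ ∷_) (Pointwise-∷ʳ⁻ xs ys xs∼ys)

take-toList-∷ʳ : ∀ x (xs : Vec A n) → q ≤ n → take q (toList (xs ∷ʳ x)) ≡ take q (toList xs)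
take-toList-∷ʳ {q = zero}  x xs       _         = refl
take-toList-∷ʳ {q = suc q} x (y ∷ xs) (s≤s q≤n) = cong (y ∷_) (take-toList-∷ʳ x xs q≤n)

sum-applyUpTo-∷ʳ : ∀ (f : ℕ → ℕ) n → sum (applyUpTo f (suc n)) ≡ sum (applyUpTo f n) + f n
sum-applyUpTo-∷ʳ f n = begin
  sum (applyUpTo f (suc n))            ≡⟨ cong sum (applyUpTo-∷ʳ f n) ⟨
  sum (applyUpTo f n ++ f n ∷ [])      ≡⟨ sum-++ (applyUpTo f n) _ ⟩
  sum (applyUpTo f n) + (f n + 0)      ≡⟨ cong (sum (applyUpTo f n) +_) (+-identityʳ (f n)) ⟩
  sum (applyUpTo f n) + f n            ∎
  where open ≡-Reasoning

sum-applyUpTo-zero : ∀ {f : ℕ → ℕ} n → (∀ j → f j ≡ 0) → sum (applyUpTo f n) ≡ 0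
sum-applyUpTo-zero zero    f≡0 = refl
sum-applyUpTo-zero (suc n) f≡0 = cong₂ _+_ (f≡0 0) (sum-applyUpTo-zero n (f≡0 ∘ suc))

sum-applyUpTo-+ : ∀ {f g h : ℕ → ℕ} n → (∀ j → h j ≡ f j + g j) →
                  sum (applyUpTo h n) ≡ sum (applyUpTo f n) + sum (applyUpTo g n)
sum-applyUpTo-+         zero    h≡f+g = refl
sum-applyUpTo-+ {f} {g} (suc n) h≡f+g =
  trans (cong₂ _+_ (h≡f+g 0) (sum-applyUpTo-+ n (h≡f+g ∘ suc))) (interchange (f 0) (g 0) _ _)

-- binomialTransform f p = Σⱼ (p C j) * f j by binomialTransform≡sum; defined by Pascal's rule,
-- it satisfies the recurrence of PrefixSmooth-card definitionally.
binomialTransform : (ℕ → ℕ) → ℕ → ℕ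
binomialTransform f zero    = f 0
binomialTransform f (suc p) = binomialTransform f p + binomialTransform (f ∘ suc) p

binomialTransform≡sum : ∀ f p {n} → p < n →
                        binomialTransform f p ≡ sum (applyUpTo (λ j → (p C j) * f j) n)
binomialTransform≡sum f zero    {suc n} _         =
  sym (trans (cong₂ _+_ (*-identityˡ (f 0)) (sum-applyUpTo-zero n λ _ → refl)) (+-identityʳ (f 0)))
binomialTransform≡sum f (suc p) {suc n} (s≤s p<n) = begin
  binomialTransform f p + binomialTransform (f ∘ suc) p
    ≡⟨ cong₂ _+_ (binomialTransform≡sum f p (m<n⇒m<1+n p<n)) (binomialTransform≡sum (f ∘ suc) p p<n) ⟩
  (1 * f 0 + S₁) + S₀     ≡⟨ +-assoc (1 * f 0) S₁ S₀ ⟩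
  1 * f 0 + (S₁ + S₀)     ≡⟨ cong (1 * f 0 +_) (+-comm S₁ S₀) ⟩
  1 * f 0 + (S₀ + S₁)     ≡⟨ cong (1 * f 0 +_) (sum-applyUpTo-+ n pascal) ⟨
  sum (applyUpTo (λ j → (suc p C j) * f j) (suc n)) ∎
  where
  open ≡-Reasoning
  S₀ = sum (applyUpTo (λ j → (p C j) * f (suc j)) n)
  S₁ = sum (applyUpTo (λ j → (p C suc j) * f (suc j)) n)
  pascal : ∀ j → (suc p C suc j) * f (suc j) ≡ (p C j) * f (suc j) + (p C suc j) * f (suc j)
  pascal j = trans (cong (_* f (suc j)) (sym (nCk+nC[k+1]≡[n+1]C[k+1] p j)))
                   (*-distribʳ-+ (f (suc j)) (p C j) (p C suc j))

binomialTransform≡1+sum : ∀ (f : ℕ → ℕ) m → f 0 ≡ 1 → f 1 ≡ 0 →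
  binomialTransform (λ j → f (suc m ∸ j)) (suc m) ≡
  1 + sum (map (λ j → (suc m C j) * f (suc m ∸ j)) (upTo m))
binomialTransform≡1+sum f m f0≡1 f1≡0 = begin
  binomialTransform (λ j → f (suc m ∸ j)) (suc m)  ≡⟨ binomialTransform≡sum _ (suc m) ≤-refl ⟩
  sum (applyUpTo g (suc (suc m)))                  ≡⟨ sum-applyUpTo-∷ʳ g (suc m) ⟩
  sum (applyUpTo g (suc m)) + g (suc m)            ≡⟨ cong (_+ g (suc m)) (sum-applyUpTo-∷ʳ g m) ⟩
  sum (applyUpTo g m) + g m + g (suc m)            ≡⟨ cong₂ (λ x y → sum (applyUpTo g m) + x + y) g[m]≡0 g[m+1]≡1 ⟩
  sum (applyUpTo g m) + 0 + 1                      ≡⟨ cong (_+ 1) (+-identityʳ _) ⟩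
  sum (applyUpTo g m) + 1                          ≡⟨ +-comm _ 1 ⟩
  1 + sum (applyUpTo g m)                          ≡⟨ cong (λ xs → 1 + sum xs) (map-upTo g m) ⟨
  1 + sum (map g (upTo m))                         ∎
  where
  open ≡-Reasoning
  g : ℕ → ℕ
  g j = (suc m C j) * f (suc m ∸ j)
  g[m]≡0 : g m ≡ 0
  g[m]≡0 = trans (cong (λ i → (suc m C m) * f i) (m+n∸n≡m 1 m))
                 (trans (cong ((suc m C m) *_) f1≡0) (*-zeroʳ (suc m C m)))
  g[m+1]≡1 : g (suc m) ≡ 1
  g[m+1]≡1 = trans (cong₂ (λ c i → c * f i) (nCn≡1 (suc m)) (n∸n≡0 m)) (trans (*-identityˡ _) f0≡1)

∃-element≥mean : ∀ x xs → ∃ λ y → y ∈ x ∷ xs × sum (x ∷ xs) ≤ length (x ∷ xs) * y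
∃-element≥mean x []       = x , here refl , ≤-refl
∃-element≥mean x (y ∷ xs) with ∃-element≥mean y xs
... | z , z∈ , mean≤z with x ≤? z
...   | yes x≤z = z , there z∈ , +-mono-≤ x≤z mean≤z
...   | no  x≰z =
  x , here refl , +-monoʳ-≤ x (≤-trans mean≤z (*-monoʳ-≤ (length (y ∷ xs)) (<⇒≤ (≰⇒> x≰z))))

∈⇒↭∷ : {x : A} {xs : List A} → x ∈ xs → ∃ λ ys → xs ↭ x ∷ ys
∈⇒↭∷ x∈xs with ∈-∃++ x∈xs
... | ys , zs , refl = ys ++ zs , shift _ ys zs

-- A pair (d , r) with d * r ≡ R stands for the unit fraction 1/d = r/R, so that
-- R ∣ b * numeratorSum ps says that b times the sum of the fractions is an integer.
UnitFractionsOver : ℕ → List (ℕ × ℕ) → Set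
UnitFractionsOver R = ListAll.All (λ (d , r) → d * r ≡ R)

numeratorSum : List (ℕ × ℕ) → ℕ
numeratorSum ps = sum (map proj₂ ps)

egyptianBound : ℕ → ℕ → ℕ
egyptianBound zero    B = 0
egyptianBound (suc k) B = suc k * B + egyptianBound k (B * (suc k * B))

largeFraction-denominator : ∀ {d r R s} b k → 0 < r → d * r ≡ R → R ≤ b * s → s ≤ k * r → d ≤ k * b
largeFraction-denominator {d} {r} {R} {s} b k 0<r dr≡R R≤bs s≤kr =
  *-cancelʳ-≤ d (k * b) r {{>-nonZero 0<r}} (begin
    d * r        ≡⟨ dr≡R ⟩
    R            ≤⟨ R≤bs ⟩
    b * s        ≤⟨ *-monoʳ-≤ b s≤kr ⟩
    b * (k * r)  ≡⟨ rearrange b k r ⟩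
    k * b * r    ∎)
  where
  open ≤-Reasoning
  rearrange : ∀ b k r → b * (k * r) ≡ k * b * r
  rearrange = solve-∀

remainingFractions-∣ : ∀ {d r R} b s → d * r ≡ R → R ∣ b * (r + s) → R ∣ b * d * s
remainingFractions-∣ {d} {r} {R} b s dr≡R R∣b[r+s] =
  ∣m+n∣m⇒∣n (subst (R ∣_) split (∣n⇒∣m*n d R∣b[r+s])) (n∣m*n b)
  where
  open ≡-Reasoning
  distribute : ∀ d b r s → d * (b * (r + s)) ≡ b * (d * r) + b * d * s
  distribute = solve-∀
  split : d * (b * (r + s)) ≡ b * R + b * d * s
  split = trans (distribute d b r s) (cong (λ x → b * x + b * d * s) dr≡R)

-- Some fraction 1/d is at least the mean, which forces d ≤ k b; the other k - 1 fractions sum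
-- to a rational whose denominator divides b d.
denominators-bounded : ∀ k {B b R} (ps : List (ℕ × ℕ)) → length ps ≡ k →
                       0 < R → UnitFractionsOver R ps → 0 < b → b ≤ B → R ∣ b * numeratorSum ps →
                       ListAll.All (λ (d , _) → d ≤ egyptianBound k B) ps
denominators-bounded zero    []       _ _ _ _ _ _ = []
denominators-bounded (suc k) {B} {b} {R} ps@(p₀ ∷ ps₀) len 0<R fractions 0<b b≤B R∣bΣ
  with ∃-element≥mean (proj₂ p₀) (map proj₂ ps₀)
... | _ , r∈ , Σ≤length*r with ∈-map⁻ proj₂ r∈
... | (d , r) , p∈ps , refl with ∈⇒↭∷ p∈ps
... | rest , ps↭ with All-resp-↭ ps↭ fractions
... | dr≡R ∷ rest-fractions =
  All-resp-↭ (↭-sym ps↭)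
    (≤-trans d≤kb (≤-trans (*-monoʳ-≤ (suc k) b≤B) (m≤m+n _ _)) ∷
     ListAll.map (λ d′≤ → ≤-trans d′≤ (m≤n+m _ _)) rest-bounded)
  where
  0<d = proj₁ (factors-positive d r dr≡R 0<R)
  0<r = proj₂ (factors-positive d r dr≡R 0<R)
  Σ≡r+Σrest : numeratorSum ps ≡ r + numeratorSum rest
  Σ≡r+Σrest = sum-↭ (↭.map⁺ proj₂ ps↭)
  0<bΣ : 0 < b * numeratorSum ps
  0<bΣ = *-mono-≤ 0<b (subst (0 <_) (sym Σ≡r+Σrest) (≤-trans 0<r (m≤m+n r _)))
  d≤kb : d ≤ suc k * b
  d≤kb = largeFraction-denominator b (suc k) 0<r dr≡R (∣⇒≤ {{>-nonZero 0<bΣ}} R∣bΣ)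
           (subst (λ l → numeratorSum ps ≤ l * r) (trans (length-map proj₂ ps) len) Σ≤length*r)
  rest-bounded : ListAll.All (λ (d , _) → d ≤ egyptianBound k (B * (suc k * B))) rest
  rest-bounded =
    denominators-bounded k rest (suc-injective (trans (sym (↭-length ps↭)) len)) 0<R rest-fractions
      (*-mono-≤ 0<b 0<d) (*-mono-≤ b≤B (≤-trans d≤kb (*-monoʳ-≤ (suc k) b≤B)))
      (remainingFractions-∣ b (numeratorSum rest) dr≡R (subst (λ Σ → R ∣ b * Σ) Σ≡r+Σrest R∣bΣ))

Labelling : ℕ → Set
Labelling m = Vec ℕ (suc m) × Vec ℕ (suc m)

-- Unlike IsArith, d₀ = 0 is allowed. This only admits d₀ = 0, R = 1 on the star without leaves,
-- and makes deleting leaves with d = 1 possible all the way down.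
record StarArith (d₀ : ℕ) (ds : Vec ℕ m) (R : ℕ) (rs : Vec ℕ m) : Set where
  constructor starArith
  field
    0<R     : 0 < R
    leaves  : Pointwise (λ d r → d * r ≡ R) ds rs
    centre  : d₀ * R ≡ Vec.sum rs
    coprime : gcd R (gcdVec rs) ≡ 1

LeadingSmooth : ℕ → Vec ℕ n → Set
LeadingSmooth q ds = ListAll.All (2 ≤_) (take q (toList ds))

LeadingSmooth-∷ʳ : ∀ {d} (ds : Vec ℕ n) → q ≤ n → LeadingSmooth q (ds ∷ʳ d) ⇔ LeadingSmooth q ds
LeadingSmooth-∷ʳ ds q≤n = mk⇔ (subst (ListAll.All (2 ≤_)) take≡) (subst (ListAll.All (2 ≤_)) (sym take≡))
  where take≡ = take-toList-∷ʳ _ ds q≤n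

PrefixSmooth : ℕ → Labelling m → Set
PrefixSmooth q (d₀ ∷ ds , R ∷ rs) = StarArith d₀ ds R rs × LeadingSmooth q ds

StarArith-rotate : ∀ {d r} → StarArith d₀ (ds ∷ʳ d) R (rs ∷ʳ r) ⇔ StarArith d₀ (d ∷ ds) R (r ∷ rs)
StarArith-rotate {ds = ds} {R = R} {rs} {r = r} = mk⇔
  (λ (starArith 0<R leaves centre coprime) → let leaves′ , dr≡R = Pointwise-∷ʳ⁻ ds rs leaves in
     starArith 0<R (dr≡R ∷ leaves′) (trans centre (sum-∷ʳ r rs))
               (trans (cong (gcd R) (sym (gcdVec-∷ʳ r rs))) coprime))
  (λ { (starArith 0<R (dr≡R ∷ leaves) centre coprime) →
     starArith 0<R (Pointwise-∷ʳ⁺ leaves dr≡R) (trans centre (sym (sum-∷ʳ r rs)))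
               (trans (cong (gcd R) (gcdVec-∷ʳ r rs)) coprime) })

StarArith-unitLeaf : StarArith (suc d₀) (1 ∷ ds) R (R ∷ rs) ⇔ StarArith d₀ ds R rs
StarArith-unitLeaf {d₀ = d₀} {R = R} = mk⇔
  (λ { (starArith 0<R (_ ∷ leaves) centre coprime) →
     starArith 0<R leaves (+-cancelˡ-≡ R (d₀ * R) _ centre) (trans (sym (gcd-absorbˡ R _)) coprime) })
  (λ (starArith 0<R leaves centre coprime) →
     starArith 0<R (*-identityˡ R ∷ leaves) (cong (R +_) centre) (trans (gcd-absorbˡ R _) coprime))

unitLeaf-inversion : ∀ {r} → StarArith d₀ (1 ∷ ds) R (r ∷ rs) → r ≡ R × ∃ λ e₀ → d₀ ≡ suc e₀
unitLeaf-inversion {d₀ = d₀} {rs = rs} {r} (starArith 0<R (1r≡R ∷ _) centre _)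
  with trans (sym (*-identityˡ r)) 1r≡R | d₀
... | r≡R | suc e₀ = r≡R , e₀ , refl
... | refl | zero  = contradiction (subst (0 <_) (sym centre) (≤-trans 0<R (m≤m+n r (Vec.sum rs)))) (<-irrefl refl)

appendUnitLeaf : Labelling m → Labelling (suc m)
appendUnitLeaf (d₀ ∷ ds , R ∷ rs) = suc d₀ ∷ (ds ∷ʳ 1) , R ∷ (rs ∷ʳ R)

moveFirstLeafLast : Labelling (suc m) → Labelling (suc m)
moveFirstLeafLast (d₀ ∷ d ∷ ds , R ∷ r ∷ rs) = d₀ ∷ (ds ∷ʳ d) , R ∷ (rs ∷ʳ r)

appendUnitLeaf-injective : Injective _≡_ _≡_ (appendUnitLeaf {m})
appendUnitLeaf-injective {x = _ ∷ ds , _ ∷ rs} {_ ∷ es , _ ∷ ss} eq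
  with ∷-injective (,-injectiveˡ eq) | ∷-injective (,-injectiveʳ eq)
... | refl , eq₁ | refl , eq₂ with ∷ʳ-injective ds es eq₁ | ∷ʳ-injective rs ss eq₂
... | refl , _ | refl , _ = refl

moveFirstLeafLast-injective : Injective _≡_ _≡_ (moveFirstLeafLast {m})
moveFirstLeafLast-injective {x = _ ∷ _ ∷ ds , _ ∷ _ ∷ rs} {_ ∷ _ ∷ es , _ ∷ _ ∷ ss} eq
  with ∷-injective (,-injectiveˡ eq) | ∷-injective (,-injectiveʳ eq)
... | refl , eq₁ | refl , eq₂ with ∷ʳ-injective ds es eq₁ | ∷ʳ-injective rs ss eq₂
... | refl , refl | refl , refl = refl

Moved Appended : ℕ → Labelling (suc m) → Set
Moved    q = Image moveFirstLeafLast (PrefixSmooth (suc q))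
Appended q = Image appendUnitLeaf (PrefixSmooth q)

Moved⊥Appended : Moved {m} q ⊥ Appended q
Moved⊥Appended (((_ ∷ _ ∷ ds , _ ∷ _ ∷ _) , (_ , 2≤d ∷ _) , refl) , ((_ ∷ es , _ ∷ _) , _ , eq)) =
  contradiction (∷ʳ-injectiveʳ ds es (proj₂ (∷-injective (,-injectiveˡ eq)))) λ { refl → <-irrefl refl 2≤d }

module _ (q≤m : q ≤ m) where

  Moved⊆PrefixSmooth : Moved {m} q ⊆ PrefixSmooth q
  Moved⊆PrefixSmooth ((_ ∷ d ∷ ds , _ ∷ _ ∷ _) , (arith , _ ∷ smooth) , refl) =
    from StarArith-rotate arith , from (LeadingSmooth-∷ʳ ds q≤m) smooth

  Appended⊆PrefixSmooth : Appended {m} q ⊆ PrefixSmooth q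
  Appended⊆PrefixSmooth ((_ ∷ ds , _ ∷ _) , (arith , smooth) , refl) =
    from StarArith-rotate (from StarArith-unitLeaf arith) , from (LeadingSmooth-∷ʳ ds q≤m) smooth

  lastLeaf-Moved∪Appended : ∀ {d r} → StarArith d₀ (d ∷ ds) R (r ∷ rs) → LeadingSmooth q ds →
                            (Moved q ∪ Appended q) (d₀ ∷ (ds ∷ʳ d) , R ∷ (rs ∷ʳ r))
  lastLeaf-Moved∪Appended {d = zero} (starArith 0<R (0≡R ∷ _) _ _) _ =
    contradiction (subst (0 <_) (sym 0≡R) 0<R) (<-irrefl refl)
  lastLeaf-Moved∪Appended {d = suc (suc _)} arith smooth = inj₁ (_ , (arith , s≤s (s≤s z≤n) ∷ smooth) , refl)
  lastLeaf-Moved∪Appended {d = 1} arith smooth with unitLeaf-inversion arith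
  ... | refl , _ , refl = inj₂ (_ , (to StarArith-unitLeaf arith , smooth) , refl)

  PrefixSmooth⊆Moved∪Appended : PrefixSmooth {suc m} q ⊆ Moved q ∪ Appended q
  PrefixSmooth⊆Moved∪Appended {_ ∷ ds⁺ , _ ∷ rs⁺} (arith , smooth) with initLast ds⁺ | initLast rs⁺
  ... | ds , d , refl | rs , r , refl =
    lastLeaf-Moved∪Appended (to StarArith-rotate arith) (to (LeadingSmooth-∷ʳ ds q≤m) smooth)

  PrefixSmooth≐Moved∪Appended : PrefixSmooth {suc m} q ≐ Moved q ∪ Appended q
  PrefixSmooth≐Moved∪Appended =
    PrefixSmooth⊆Moved∪Appended , λ { (inj₁ moved)    → Moved⊆PrefixSmooth moved
                                    ; (inj₂ appended) → Appended⊆PrefixSmooth appended }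

PrefixSmooth-card-step : q ≤ m → HasCard (PrefixSmooth {suc m} (suc q)) a → HasCard (PrefixSmooth {m} q) b →
                         HasCard (PrefixSmooth {suc m} q) (a + b)
PrefixSmooth-card-step q≤m moved appended =
  HasCard-resp-≐ (≐-sym (PrefixSmooth≐Moved∪Appended q≤m))
    (HasCard-∪ Moved⊥Appended (HasCard-image moveFirstLeafLast-injective moved)
                              (HasCard-image appendUnitLeaf-injective appended))

PrefixSmooth-card : (c : ℕ → ℕ) → (∀ m → HasCard (PrefixSmooth {m} m) (c m)) →
                    ∀ p {q m} → p + q ≡ m →
                    HasCard (PrefixSmooth {m} q) (binomialTransform (λ j → c (m ∸ j)) p)
PrefixSmooth-card c smooth-card zero        refl = smooth-card _
PrefixSmooth-card c smooth-card (suc p) {q} refl =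
  PrefixSmooth-card-step (m≤n+m q p) (PrefixSmooth-card c smooth-card p (+-suc p q))
                                     (PrefixSmooth-card c smooth-card p refl)

leaves-positive : 0 < R → Pointwise (λ d r → d * r ≡ R) ds rs → VecAll.All (0 <_) ds × VecAll.All (0 <_) rs
leaves-positive 0<R []                                = [] , []
leaves-positive 0<R (_∷_ {x = d} {r} dr≡R leaves) =
  let 0<d , 0<r = factors-positive d r dr≡R 0<R ; 0<ds , 0<rs = leaves-positive 0<R leaves in
  0<d ∷ 0<ds , 0<r ∷ 0<rs

leaves-≤ : 0 < R → Pointwise (λ d r → d * r ≡ R) ds rs → VecAll.All (_≤ R) rs
leaves-≤ 0<R []                               = []
leaves-≤ 0<R (_∷_ {x = d} {r} dr≡R leaves) =
  subst (r ≤_) dr≡R (m≤n*m r d {{>-nonZero (proj₁ (factors-positive d r dr≡R 0<R))}}) ∷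
  leaves-≤ 0<R leaves

leaves-∣ : Pointwise (λ d r → d * r ≡ R) ds rs → VecAll.All (_∣ k) ds → VecAll.All (λ r → R ∣ k * r) rs
leaves-∣         []                          []           = []
leaves-∣ {k = k} (_∷_ {y = r} dr≡R leaves) (d∣k ∷ ds∣k) =
  subst (_∣ k * r) dr≡R (*-monoˡ-∣ r d∣k) ∷ leaves-∣ leaves ds∣k

leafPairs : Vec ℕ n → Vec ℕ n → List (ℕ × ℕ)
leafPairs ds rs = toList (Vec.zip ds rs)

leafPairs-unitFractions : Pointwise (λ d r → d * r ≡ R) ds rs → UnitFractionsOver R (leafPairs ds rs)
leafPairs-unitFractions []              = []
leafPairs-unitFractions (dr≡R ∷ leaves) = dr≡R ∷ leafPairs-unitFractions leaves

numeratorSum-leafPairs : ∀ (ds rs : Vec ℕ n) → numeratorSum (leafPairs ds rs) ≡ Vec.sum rs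
numeratorSum-leafPairs []       []       = refl
numeratorSum-leafPairs (_ ∷ ds) (r ∷ rs) = cong (r +_) (numeratorSum-leafPairs ds rs)

leafPairs-denominators : ∀ {P : ℕ → Set} (ds rs : Vec ℕ n) →
                         ListAll.All (P ∘ proj₁) (leafPairs ds rs) → VecAll.All P ds
leafPairs-denominators []       []       []       = []
leafPairs-denominators (_ ∷ ds) (_ ∷ rs) (p ∷ ps) = p ∷ leafPairs-denominators ds rs ps

module _ {d₀ R : ℕ} {ds rs : Vec ℕ m} (arith : StarArith d₀ ds R rs) where
  open StarArith arith

  centre≤m : d₀ ≤ m
  centre≤m = *-cancelʳ-≤ d₀ m R {{>-nonZero 0<R}}
               (subst (_≤ m * R) (sym centre) (sum≤length*bound (leaves-≤ 0<R leaves)))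

  leaves≤egyptianBound : VecAll.All (_≤ egyptianBound m 1) ds
  leaves≤egyptianBound =
    leafPairs-denominators ds rs
      (denominators-bounded m (leafPairs ds rs) (length-toList (Vec.zip ds rs))
         0<R (leafPairs-unitFractions leaves) z<s ≤-refl R∣Σ)
    where
    R∣Σ : R ∣ 1 * numeratorSum (leafPairs ds rs)
    R∣Σ = subst (R ∣_) (sym (trans (*-identityˡ _) (trans (numeratorSum-leafPairs ds rs) (sym centre)))) (n∣m*n d₀)

  R≤product : R ≤ product (toList ds)
  R≤product = ∣⇒≤ {{product≢0 (ListAll.map >-nonZero (VecAll.toList⁺ {xs = ds} 0<ds))}} R∣Π
    where
    0<ds = proj₁ (leaves-positive 0<R leaves)
    Π = product (toList ds)
    R∣Π : R ∣ Π
    R∣Π = subst (R ∣_) (trans (cong (Π *_) coprime) (*-identityʳ Π))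
            (∣-*-gcdVec {c = Π} (n∣m*n Π ∷ leaves-∣ leaves (VecAll.toList⁻ (ListAll.tabulate ∈⇒∣product))))

starBound : ℕ → ℕ
starBound m = m + (egyptianBound m 1 + egyptianBound m 1 ^ m)

StarArith-bounded : ∀ {m d₀ R} {ds rs : Vec ℕ m} → StarArith d₀ ds R rs →
                    VecAll.All (_≤ starBound m) (d₀ ∷ ds) × VecAll.All (_≤ starBound m) (R ∷ rs)
StarArith-bounded {m} {R = R} arith =
  ≤-trans (centre≤m arith) (m≤m+n m _) ∷ VecAll.map (λ d≤D → ≤-trans d≤D D≤bound) (leaves≤egyptianBound arith) ,
  R≤bound ∷ VecAll.map (λ r≤R → ≤-trans r≤R R≤bound) (leaves-≤ 0<R leaves)
  where
  open StarArith arith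
  D = egyptianBound m 1
  D≤bound : D ≤ starBound m
  D≤bound = ≤-trans (m≤m+n D _) (m≤n+m _ m)
  R≤bound : R ≤ starBound m
  R≤bound = ≤-trans (R≤product arith)
              (≤-trans (product≤bound^length (leaves≤egyptianBound arith)) (≤-trans (m≤n+m _ D) (m≤n+m _ m)))

StarArith? : ∀ d₀ (ds : Vec ℕ m) R rs → Dec (StarArith d₀ ds R rs)
StarArith? d₀ ds R rs =
  map′ (λ (0<R , leaves , centre , coprime) → starArith 0<R leaves centre coprime)
       (λ (starArith 0<R leaves centre coprime) → 0<R , leaves , centre , coprime)
       ((0 <? R) ×-dec Pointwise.decidable (λ d r → d * r ≟ R) ds rs ×-dec
        (d₀ * R ≟ Vec.sum rs) ×-dec (gcd R (gcdVec rs) ≟ 1))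

PrefixSmooth? : ∀ q → Decidable (PrefixSmooth {m} q)
PrefixSmooth? q (d₀ ∷ ds , R ∷ rs) = StarArith? d₀ ds R rs ×-dec ListAll.all? (2 ≤?_) (take q (toList ds))

PrefixSmooth-finite : ∀ m q → Σ ℕ (HasCard (PrefixSmooth {m} q))
PrefixSmooth-finite m q =
  finite-if-bounded (starBound m) (PrefixSmooth? q) λ { (_ ∷ _ , _ ∷ _) (arith , _) → StarArith-bounded arith }

leaflessStar : PrefixSmooth {0} 0 ≐ ｛ 0 ∷ [] , 1 ∷ [] ｝
leaflessStar = (λ { {d₀ ∷ [] , R ∷ []} (starArith _ [] centre coprime , []) →
                    unique d₀ R centre (trans (sym (gcd-identityʳ R)) coprime) })
             , λ { refl → starArith z<s [] refl refl , [] }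
  where
  unique : ∀ d₀ R → d₀ * R ≡ 0 → R ≡ 1 → (0 ∷ [] , 1 ∷ []) ≡ (d₀ ∷ [] , R ∷ [])
  unique d₀ R centre refl with trans (sym (*-identityʳ d₀)) centre
  ... | refl = refl

S₁-not-smooth : Empty (PrefixSmooth {1} 1)
S₁-not-smooth (d₀ ∷ d ∷ [] , R ∷ r ∷ []) (starArith 0<R (dr≡R ∷ []) centre _ , 2≤d ∷ []) =
  <-irrefl (sym (m*n≡1⇒n≡1 d₀ d d₀d≡1)) 2≤d
  where
  d₀d≡1 : d₀ * d ≡ 1
  d₀d≡1 = *-cancelʳ-≡ (d₀ * d) 1 r {{>-nonZero (proj₂ (factors-positive d r dr≡R 0<R))}} (begin
    d₀ * d * r   ≡⟨ *-assoc d₀ d r ⟩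
    d₀ * (d * r) ≡⟨ cong (d₀ *_) dr≡R ⟩
    d₀ * R       ≡⟨ centre ⟩
    1 * r        ∎)
    where open ≡-Reasoning

sum-tabulate-0 : ∀ n → Vec.sum (tabulate {n = n} λ _ → 0) ≡ 0
sum-tabulate-0 zero    = refl
sum-tabulate-0 (suc n) = sum-tabulate-0 n

neighbourSum-star-centre : ∀ R (rs : Vec ℕ m) → neighbourSum (star m) (R ∷ rs) zero ≡ Vec.sum rs
neighbourSum-star-centre R rs = cong Vec.sum (tabulate∘lookup rs)

neighbourSum-star-leaf : ∀ R (rs : Vec ℕ m) i → neighbourSum (star m) (R ∷ rs) (suc i) ≡ R
neighbourSum-star-leaf {m} R rs i = trans (cong (R +_) (sum-tabulate-0 m)) (+-identityʳ R)

IsArith-star⇔StarArith : ∀ {ds rs : Vec ℕ (suc m)} →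
                         IsArith (star (suc m)) (d₀ ∷ ds , R ∷ rs) ⇔ StarArith d₀ ds R rs
IsArith-star⇔StarArith {d₀ = d₀} {R} {ds} {rs} = mk⇔
  (λ { (_ , 0<R ∷ _ , equations , coprime) →
     let equation = VecAll.tabulate⁻ {f = λ v → v} equations in
     starArith 0<R
       (to Extensional.equivalent (Extensional.ext λ i → trans (equation (suc i)) (neighbourSum-star-leaf R rs i)))
       (trans (equation zero) (neighbourSum-star-centre R rs)) coprime })
  (λ arith@(starArith 0<R leaves centre coprime) →
     let 0<ds , 0<rs = leaves-positive 0<R leaves in
     0<centre arith ∷ 0<ds , 0<R ∷ 0<rs ,
     VecAll.tabulate⁺ {f = λ v → v}
       (λ { zero    → trans centre (sym (neighbourSum-star-centre R rs))
          ; (suc i) → trans (Pointwise.lookup leaves i) (sym (neighbourSum-star-leaf R rs i)) }) ,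
     coprime)
  where
  0<centre : StarArith d₀ ds R rs → 0 < d₀
  0<centre (starArith 0<R (_∷_ {x = d} {r} dr≡R _) centre _) =
    proj₁ (factors-positive d₀ R refl (subst (0 <_) (sym centre) (≤-trans 0<r (m≤m+n r _))))
    where 0<r = proj₂ (factors-positive d r dr≡R 0<R)

smoothLeaves⇔ : ∀ {xs : Vec ℕ n} → VecAll.All (λ i → 2 ≤ lookup xs i) (tabulate (λ i → i)) ⇔ LeadingSmooth n xs
smoothLeaves⇔ {n} {xs} = mk⇔
  (subst (ListAll.All (2 ≤_)) (sym take-toList) ∘ VecAll.toList⁺ ∘ VecAll.lookup⁻ ∘ VecAll.tabulate⁻)
  (VecAll.tabulate⁺ ∘ VecAll.lookup⁺ ∘ VecAll.toList⁻ ∘ subst (ListAll.All (2 ≤_)) take-toList)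
  where
  take-toList : take n (toList xs) ≡ toList xs
  take-toList = take-all n (toList xs) (≤-reflexive (length-toList xs))

IsArith-star≐PrefixSmooth : IsArith (star (suc m)) ≐ PrefixSmooth 0
IsArith-star≐PrefixSmooth =
  (λ { {_ ∷ _ , _ ∷ _} arith → to IsArith-star⇔StarArith arith , [] }) ,
  (λ { {_ ∷ _ , _ ∷ _} (arith , _) → from IsArith-star⇔StarArith arith })

IsSmoothArithStar≐PrefixSmooth : IsSmoothArithStar (suc m) ≐ PrefixSmooth (suc m)
IsSmoothArithStar≐PrefixSmooth =
  (λ { {_ ∷ _ , _ ∷ _} (arith , smooth) → to IsArith-star⇔StarArith arith , to smoothLeaves⇔ smooth }) ,
  (λ { {_ ∷ _ , _ ∷ _} (arith , smooth) → from IsArith-star⇔StarArith arith , from smoothLeaves⇔ smooth })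

smoothCount : ℕ → ℕ
smoothCount zero            = 1
smoothCount (suc zero)      = 0
smoothCount m@(suc (suc _)) = proj₁ (PrefixSmooth-finite m m)

PrefixSmooth-card-smooth : ∀ m → HasCard (PrefixSmooth {m} m) (smoothCount m)
PrefixSmooth-card-smooth zero          = HasCard-resp-≐ (≐-sym leaflessStar) (HasCard-｛｝ _)
PrefixSmooth-card-smooth (suc zero)    = HasCard-∅ S₁-not-smooth
PrefixSmooth-card-smooth (suc (suc m)) = proj₂ (PrefixSmooth-finite _ _)

corollary4p11 : (s : ℕ) → 2 ≤ s →
    Σ ℕ λ N → Σ (ℕ → ℕ) λ c →
      HasCard (IsArith (star s)) N ×
      ((k : ℕ) → 2 ≤ k → k ≤ s → HasCard (IsSmoothArithStar k) (c k)) ×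
      N ≡ 1 + sum (map (λ j → (s C j) * c (s ∸ j)) (upTo (s ∸ 1)))
corollary4p11 s@(suc m) _ =
  binomialTransform (λ j → smoothCount (s ∸ j)) s , smoothCount ,
  HasCard-resp-≐ (≐-sym IsArith-star≐PrefixSmooth)
    (PrefixSmooth-card smoothCount PrefixSmooth-card-smooth s (+-identityʳ s)) ,
  (λ { (suc k) _ _ → HasCard-resp-≐ (≐-sym IsSmoothArithStar≐PrefixSmooth) (PrefixSmooth-card-smooth (suc k)) }) ,
  binomialTransform≡1+sum smoothCount m refl refl
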